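{- Let $m\ge2$, $\mathbf{m}=(k_1,\dots,k_m)$ with $k_i\ge0$, and $w=w_1w_2\cdots w_n\in\mathfrak{S}_{\mathbf m}$. Write $\theta_{(m-2)!}(w)=c_1c_2\cdots c_n$ and set $w_0=m$. For $i\in[n]$: if $w_i=m$ then $c_i=m$; if $w_i<m$ then $c_i\in R_i-1$, where $R_i=\{w_{i-1},w_i,\ldots,w_n,m\}$ and $S-1=\{s-1:s\in S\}$.
   Context: $\mathfrak{S}_{\mathbf m}$ is the set of words with exactly $k_i$ copies of $i$ for each $i\in[m]$. For $1\le i\le m-1$, $\theta_i$ acts on a word as follows: replace every factor $(i+1)i$ by a special symbol $\sim$; in the resulting word each maximal factor consisting only of letters $i$ and $i+1$ has the form $i^a(i+1)^b$ ($a,b\ge0$), and it is replaced by $i^b(i+1)^a$; then each $\sim$ is replaced back by $(i+1)i$. $\theta_0=\mathrm{id}$ and $\theta_{j!}=\theta_j\circ\cdots\circ\theta_1\circ\theta_0$. -}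

module Defs where

open import Data.Nat using (ℕ; zero; suc; _≤_; _∸_; _≟_; _≡ᵇ_)
open import Data.Bool using (if_then_else_)
open import Data.List using (List; []; _∷_; _++_; replicate; length; filter; drop; [_])
open import Data.Fin using (Fin; toℕ)
open import Data.Maybe using (Maybe; just; nothing; fromMaybe)
open import Data.Product using (_×_)
open import Data.List.Relation.Unary.All using (All)
open import Relation.Nullary using (yes; no)
open import Relation.Binary.PropositionalEquality using (_≡_)

count : ℕ → List ℕ → ℕ
count j w = length (filter (_≟ j) w)

-- w ∈ 𝔖_𝐦 where 𝐦 = (k_1,…,k_m) is given by k : Fin m → ℕ,
-- k (index i-1) = k_i : every letter lies in [m] and letter i occurs k_i times.
InS : (m : ℕ) → (Fin m → ℕ) → List ℕ → Set
InS m k w = All (λ x → 1 ≤ x × x ≤ m) w × ((j : Fin m) → count (suc (toℕ j)) w ≡ k j)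

-- Scanning left to right we keep the current maximal run of letters
-- i, i+1 not involved in a factor (i+1)i; such a run has the form i^a (i+1)^b,
-- so it is recorded by (a , b) and replaced by i^b (i+1)^a when it ends.
-- A factor (i+1)i (the symbol ~) ends the run and is copied unchanged.
module Theta (i : ℕ) where
  flush : ℕ → ℕ → List ℕ
  flush a b = replicate b i ++ replicate a (suc i)

  mutual
    go : ℕ → ℕ → List ℕ → List ℕ
    go a b [] = flush a b
    go a b (x ∷ xs) = step a b x xs

    step : ℕ → ℕ → ℕ → List ℕ → List ℕ
    step a b x xs =
      if x ≡ᵇ suc i then high a b xs
      else (if x ≡ᵇ i then go (suc a) b xs
            else flush a b ++ (x ∷ go 0 0 xs))

    -- we have just read a letter i+1 (not yet counted)
    high : ℕ → ℕ → List ℕ → List ℕ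
    high a b [] = flush a (suc b)
    high a b (y ∷ ys) =
      if y ≡ᵇ i then flush a b ++ (suc i ∷ i ∷ go 0 0 ys)
      else step a (suc b) y ys

θ : ℕ → List ℕ → List ℕ
θ i w = Theta.go i 0 0 w

θ! : ℕ → List ℕ → List ℕ
θ! zero w = w
θ! (suc j) w = θ (suc j) (θ! j w)

-- 0-indexed lookup: at w p = just w_{p+1}.
at : List ℕ → ℕ → Maybe ℕ
at [] _ = nothing
at (x ∷ xs) zero = just x
at (x ∷ xs) (suc p) = at xs p

-- For the 0-indexed position p (i.e. i = p+1):
-- R_i = {w_{i-1}, w_i, …, w_n, m} with w_0 = m, as a list.
R : ℕ → List ℕ → ℕ → List ℕ
R m w zero = m ∷ (w ++ [ m ])
R m w (suc q) = fromMaybe m (at w q) ∷ (drop (suc q) w ++ [ m ])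

{-# OPTIONS --safe #-}
-- θ_i acts letter by letter in a controlled way: letters other than i, i+1 are fixed, the letters
-- i, i+1 stay in {i, i+1}, and an output letter i only occurs where the input has an i+1 at or
-- after that position, or just before it (a factor (i+1)i).  Composing these local descriptions,
-- after θ_{(n-1)!} every letter x > n is unchanged, while a letter x ≤ n has become either n or
-- s - 1 for some s among the letter before it and the letters from it onwards (Descends n).
-- For n = m - 1 this is the lemma, the value m - 1 accounting for the extra element m of R_i.
module Submission where

open import Defs
open import Data.Nat using (ℕ; zero; suc; pred; _+_; _≤_; _<_; _∸_; _≡ᵇ_; z≤n; s≤s; _≟_; _≤?_)
open import Data.Nat.Properties using
  ( ≡ᵇ⇒≡; ≡⇒≡ᵇ; 1+n≢n; 1+n≰n; <⇒≤; ≤⇒≯; ≰⇒>; ≤∧≢⇒<; n≤1+n; m≤n⇒m≤1+n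
  ; ≤-refl; ≤-reflexive; ≤-antisym; ≤-pred; +-comm )
open import Data.Bool using (true; false; if_then_else_)
open import Data.Fin using (Fin)
open import Data.List using (List; []; _∷_; _++_; replicate; length; drop; [_])
open import Data.List.Properties using (++-assoc; ++-identityʳ; length-++; length-replicate)
open import Data.List.Membership.Propositional using (_∈_)
open import Data.List.Membership.Propositional.Properties using (∈-++⁺ˡ; ∈-++⁺ʳ)
open import Data.List.Relation.Unary.Any using (here; there)
open import Data.List.Relation.Unary.All using (All; []; _∷_)
import Data.List.Relation.Unary.All as All
open import Data.List.Relation.Unary.All.Properties using (++⁺; replicate⁺)
open import Data.Maybe using (just)
open import Data.Product using (_×_; _,_; proj₁; proj₂; ∃-syntax)
open import Data.Sum using (_⊎_; inj₁; inj₂)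
open import Data.Empty using (⊥-elim)
open import Relation.Nullary using (¬_; yes; no)
open import Relation.Nullary.Decidable using (_⊎-dec_)
open import Relation.Nullary.Reflects using (Reflects; ofʸ; ofⁿ; fromEquivalence)
open import Relation.Binary.PropositionalEquality
  using (_≡_; _≢_; refl; sym; trans; cong; cong₂; subst)
open import Function using (_∘_)

variable
  A : Set
  i n pv pu p x y : ℕ
  s w u o : List ℕ

≡ᵇ-reflects-≡ : ∀ m n → Reflects (m ≡ n) (m ≡ᵇ n)
≡ᵇ-reflects-≡ m n = fromEquivalence (≡ᵇ⇒≡ m n) (≡⇒≡ᵇ m n)

replicate-++-∷ : ∀ k (c : A) xs → replicate k c ++ c ∷ xs ≡ replicate (suc k) c ++ xs
replicate-++-∷ zero    c xs = refl
replicate-++-∷ (suc k) c xs = cong (c ∷_) (replicate-++-∷ k c xs)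

length-replicate-++ : ∀ k l {c d : A} → length (replicate k c ++ replicate l d) ≡ k + l
length-replicate-++ k l =
  trans (length-++ (replicate k _)) (cong₂ _+_ (length-replicate k) (length-replicate l))

data Tracks (P : ℕ → ℕ → List ℕ → ℕ → Set) : ℕ → List ℕ → List ℕ → Set where
  []  : Tracks P pv [] []
  _∷_ : P pv x w y → Tracks P x w u → Tracks P pv (x ∷ w) (y ∷ u)

letterBefore : ℕ → List ℕ → ℕ → ℕ
letterBefore d w       zero    = d
letterBefore d []      (suc q) = d
letterBefore d (x ∷ w) (suc q) = letterBefore x w q

module _ {P : ℕ → ℕ → List ℕ → ℕ → Set} where

  input-≡ : w ≡ s → Tracks P pv w u → Tracks P pv s u
  input-≡ refl t = t

  Tracks-++ : (∀ {pv x s y} s′ → P pv x s y → P pv x (s ++ s′) y) →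
              Tracks P pv w u → (∀ {q} → Tracks P q s o) → Tracks P pv (w ++ s) (u ++ o)
  Tracks-++ extend [] rest = rest
  Tracks-++ {s = s} extend (r ∷ rs) rest = extend s r ∷ Tracks-++ extend rs rest

  Tracks-∈ : ∀ c → (∀ {pv x s y} → P pv x s y → c ≡ y → c ≡ x) →
             Tracks P pv w u → c ∈ u → c ∈ w
  Tracks-∈ c reflect (r ∷ rs) (here refl) = here (reflect r refl)
  Tracks-∈ c reflect (r ∷ rs) (there c∈u) = there (Tracks-∈ c reflect rs c∈u)

  Tracks-at : Tracks P pv w u → at w p ≡ just x →
              ∃[ y ] (at u p ≡ just y × P (letterBefore pv w p) x (drop (suc p) w) y)
  Tracks-at {p = zero}  (r ∷ rs) refl = _ , refl , r
  Tracks-at {p = suc p} (r ∷ rs) w[p]≡x = Tracks-at rs w[p]≡x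

at-letterBefore : ∀ d w q → at w (suc q) ≡ just x → at w q ≡ just (letterBefore d w (suc q))
at-letterBefore d (_ ∷ _ ∷ _) zero    _ = refl
at-letterBefore d (_ ∷ w)     (suc q) e = at-letterBefore _ w q e

drop-at : ∀ w p → at w p ≡ just x → drop p w ≡ x ∷ drop (suc p) w
drop-at (_ ∷ w) zero    refl = refl
drop-at (_ ∷ w) (suc p) e    = drop-at w p e

R-context : ∀ m w p → at w p ≡ just x →
            R m w p ≡ (letterBefore m w p ∷ x ∷ drop (suc p) w) ++ [ m ]
R-context m (_ ∷ w) zero    refl = refl
R-context m w       (suc q) e
  rewrite at-letterBefore m w q e | drop-at w (suc q) e = refl

InPair : ℕ → ℕ → Set
InPair i x = x ≡ i ⊎ x ≡ suc i

InPair-≤ : InPair n y → y ≤ suc n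
InPair-≤ (inj₁ refl) = n≤1+n _
InPair-≤ (inj₂ refl) = ≤-refl

record ThetaStep (i pv x : ℕ) (s : List ℕ) (y : ℕ) : Set where
  field
    pair↦pair      : InPair i x → InPair i y
    other-fixed    : ¬ InPair i x → y ≡ x
    low-needs-high : y ≡ i → suc i ∈ pv ∷ x ∷ s

ThetaStep-++ : ∀ s′ → ThetaStep i pv x s y → ThetaStep i pv x (s ++ s′) y
ThetaStep-++ s′ t = record
  { pair↦pair = pair↦pair ; other-fixed = other-fixed
  ; low-needs-high = λ y≡i → ∈-++⁺ˡ (low-needs-high y≡i) }
  where open ThetaStep t

pair-step : InPair i x → InPair i y → (y ≡ i → suc i ∈ pv ∷ x ∷ s) → ThetaStep i pv x s y
pair-step x∈ y∈ low = record
  { pair↦pair = λ _ → y∈ ; other-fixed = λ x∉ → ⊥-elim (x∉ x∈) ; low-needs-high = low }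

other-step : ¬ InPair i x → ThetaStep i pv x s x
other-step x∉ = record
  { pair↦pair = λ x∈ → ⊥-elim (x∉ x∈) ; other-fixed = λ _ → refl
  ; low-needs-high = λ x≡i → ⊥-elim (x∉ (inj₁ x≡i)) }

module ThetaTracks (i : ℕ) where
  open Theta i

  block-ending-high : All (InPair i) w → All (InPair i) u → length u ≡ suc (length w) →
              Tracks (ThetaStep i) pv (w ++ [ suc i ]) u
  block-ending-high []         (y∈ ∷ [])  refl = pair-step (inj₂ refl) y∈ (λ _ → there (here refl)) ∷ []
  block-ending-high {w = _ ∷ w} (x∈ ∷ xs) (y∈ ∷ ys) len =
    pair-step x∈ y∈ (λ _ → there (there (∈-++⁺ʳ w (here refl)))) ∷ block-ending-high xs ys (cong pred len)

  low-block : ∀ k → Tracks (ThetaStep i) pv (replicate k i) (replicate k (suc i))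
  low-block zero    = []
  low-block (suc k) = pair-step (inj₁ refl) (inj₂ refl) (⊥-elim ∘ 1+n≢n) ∷ low-block k

  flush-high : ∀ a b →
    Tracks (ThetaStep i) pv (replicate a i ++ replicate b (suc i) ++ [ suc i ]) (flush a (suc b))
  flush-high a b = input-≡ (++-assoc (replicate a i) _ _)
    (block-ending-high (++⁺ (replicate⁺ a (inj₁ refl)) (replicate⁺ b (inj₂ refl)))
               (++⁺ (replicate⁺ (suc b) (inj₁ refl)) (replicate⁺ a (inj₂ refl))) len)
    where
      len : length (flush a (suc b)) ≡ suc (length (replicate a i ++ replicate b (suc i)))
      len = trans (length-replicate-++ (suc b) a)
                  (cong suc (trans (+-comm b a) (sym (length-replicate-++ a b))))

  flush-tracks : ∀ a b → Tracks (ThetaStep i) pv (replicate a i ++ replicate b (suc i)) (flush a b)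
  flush-tracks a zero    = input-≡ (sym (++-identityʳ (replicate a i))) (low-block a)
  flush-tracks a (suc b) =
    input-≡ (cong (replicate a i ++_) (trans (replicate-++-∷ b (suc i) []) (++-identityʳ _)))
      (flush-high a b)

  run : ℕ → ℕ → List ℕ → List ℕ
  run a b xs = replicate a i ++ replicate b (suc i) ++ xs

  flush-then : ∀ {xs ys} a b → (∀ {q} → Tracks (ThetaStep i) q xs ys) →
               Tracks (ThetaStep i) pv (run a b xs) (flush a b ++ ys)
  flush-then {xs = xs} a b rest = input-≡ (++-assoc (replicate a i) _ xs)
    (Tracks-++ ThetaStep-++ (flush-tracks a b) rest)

  mutual
    go-tracks : ∀ a xs → Tracks (ThetaStep i) pv (run a 0 xs) (go a 0 xs)
    go-tracks a []       = flush-tracks a 0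
    go-tracks a (x ∷ xs) = step-tracks a 0 x xs (≡ᵇ-reflects-≡ x (suc i)) (≡ᵇ-reflects-≡ x i) (inj₁ refl)

    -- The two tests of step are taken as Reflects arguments, so that this lemma also applies
    -- inside high, where the test x ≡ᵇ i has already been evaluated.
    step-tracks : ∀ {β γ} a b x xs → Reflects (x ≡ suc i) β → Reflects (x ≡ i) γ → b ≡ 0 ⊎ x ≢ i →
      Tracks (ThetaStep i) pv (run a b (x ∷ xs))
        (if β then high a b xs else if γ then go (suc a) b xs else flush a b ++ x ∷ go 0 0 xs)
    step-tracks a b x xs (ofʸ refl) _ _ = high-tracks a b xs
    step-tracks a b x xs (ofⁿ _) (ofʸ refl) (inj₁ refl) =
      input-≡ (sym (replicate-++-∷ a i xs)) (go-tracks (suc a) xs)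
    step-tracks a b x xs (ofⁿ _) (ofʸ refl) (inj₂ i≢i) = ⊥-elim (i≢i refl)
    step-tracks a b x xs (ofⁿ x≢1+i) (ofⁿ x≢i) _ = flush-then a b (other-step x∉ ∷ go-tracks 0 xs)
      where
        x∉ : ¬ InPair i x
        x∉ (inj₁ x≡i)   = x≢i x≡i
        x∉ (inj₂ x≡1+i) = x≢1+i x≡1+i

    high-tracks : ∀ a b xs → Tracks (ThetaStep i) pv (run a b (suc i ∷ xs)) (high a b xs)
    high-tracks a b []       = flush-high a b
    high-tracks a b (y ∷ ys) with y ≡ᵇ i | ≡ᵇ-reflects-≡ y i
    ... | true  | ofʸ refl = flush-then a b
      (pair-step (inj₂ refl) (inj₂ refl) (⊥-elim ∘ 1+n≢n) ∷
       pair-step (inj₁ refl) (inj₁ refl) (λ _ → here refl) ∷ go-tracks 0 ys)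
    ... | false | ofⁿ y≢i =
      input-≡ (sym (cong (replicate a i ++_) (replicate-++-∷ b (suc i) (y ∷ ys))))
        (step-tracks a (suc b) y ys (≡ᵇ-reflects-≡ y (suc i)) (ofⁿ y≢i) (inj₂ y≢i))

θ-tracks : ∀ i w → Tracks (ThetaStep i) pv w (θ i w)
θ-tracks i w = ThetaTracks.go-tracks i 0 w

record Descends (n pv x : ℕ) (s : List ℕ) (y : ℕ) : Set where
  field
    high-fixed   : n < x → y ≡ x
    low-bounded  : x ≤ n → y ≤ n
    low-descends : x ≤ n → suc y ∈ pv ∷ x ∷ s ⊎ y ≡ n

Descends-top : Descends n pv x s y → suc n ≡ y → suc n ≡ x
Descends-top {n} {x = x} d 1+n≡y with x ≤? n
... | yes x≤n = ⊥-elim (1+n≰n (subst (_≤ n) (sym 1+n≡y) (Descends.low-bounded d x≤n)))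
... | no  x≰n = trans 1+n≡y (Descends.high-fixed d (≰⇒> x≰n))

descends-id : All (1 ≤_) w → Tracks (Descends 1) pv w w
descends-id []            = []
descends-id (1≤x ∷ 1≤xs) = record
  { high-fixed   = λ _ → refl
  ; low-bounded  = λ x≤1 → x≤1
  ; low-descends = λ x≤1 → inj₂ (≤-antisym x≤1 1≤x) }
  ∷ descends-id 1≤xs

descends-step : ∀ {t z} → (suc n ∈ pu ∷ y ∷ t → suc n ∈ pv ∷ x ∷ s) →
                Descends n pv x s y → ThetaStep n pu y t z → Descends (suc n) pv x s z
descends-step {n = n} {y = y} {pv = pv} {x = x} {s = s} {z = z} transfer d θy = record
  { high-fixed   = high-fixed′
  ; low-bounded  = λ x≤1+n → proj₁ (low x≤1+n)
  ; low-descends = λ x≤1+n → proj₂ (low x≤1+n) }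
  where
    open Descends d
    open ThetaStep θy

    high-fixed′ : suc n < x → z ≡ x
    high-fixed′ 1+n<x = trans (other-fixed y∉) y≡x
      where
        y≡x : y ≡ x
        y≡x = high-fixed (<⇒≤ 1+n<x)
        y∉ : ¬ InPair n y
        y∉ y∈ = ≤⇒≯ (InPair-≤ y∈) (subst (suc n <_) (sym y≡x) 1+n<x)

    outside : ¬ InPair n y → x ≤ n → y ≤ suc n × (suc y ∈ pv ∷ x ∷ s ⊎ y ≡ suc n)
    outside y∉ x≤n with low-descends x≤n
    ... | inj₁ 1+y∈ = m≤n⇒m≤1+n (low-bounded x≤n) , inj₁ 1+y∈
    ... | inj₂ y≡n  = ⊥-elim (y∉ (inj₁ y≡n))

    low : x ≤ suc n → z ≤ suc n × (suc z ∈ pv ∷ x ∷ s ⊎ z ≡ suc n)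
    low x≤1+n with (y ≟ n) ⊎-dec (y ≟ suc n)
    ... | yes y∈ with pair↦pair y∈
    ...   | inj₁ refl = n≤1+n n , inj₁ (transfer (low-needs-high refl))
    ...   | inj₂ refl = ≤-refl , inj₂ refl
    low x≤1+n | no y∉ rewrite other-fixed y∉ = outside y∉ (≤-pred (≤∧≢⇒< x≤1+n x≢1+n))
      where
        x≢1+n : x ≢ suc n
        x≢1+n x≡1+n = y∉ (inj₂ (trans (high-fixed (≤-reflexive (sym x≡1+n))) x≡1+n))

Descends-∈ : (suc n ≡ pu → suc n ≡ pv) → Tracks (Descends n) pv w u → suc n ∈ pu ∷ u → suc n ∈ pv ∷ w
Descends-∈ top _  (here 1+n≡pu)  = here (top 1+n≡pu)
Descends-∈ top ds (there 1+n∈u) = there (Tracks-∈ _ Descends-top ds 1+n∈u)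

descends-θ : Tracks (Descends n) pv w u → Tracks (ThetaStep n) pu u o → (suc n ≡ pu → suc n ≡ pv) →
             Tracks (Descends (suc n)) pv w o
descends-θ []       []       _   = []
descends-θ (d ∷ ds) (t ∷ ts) top =
  descends-step (Descends-∈ top (d ∷ ds)) d t ∷ descends-θ ds ts (Descends-top d)

descends-θ! : ∀ j → All (1 ≤_) w → Tracks (Descends (suc j)) pv w (θ! j w)
descends-θ! zero    1≤w = descends-id 1≤w
descends-θ! (suc j) 1≤w = descends-θ (descends-θ! j 1≤w) (θ-tracks {pv = 0} (suc j) _) λ ()

lemma5p3 : (m : ℕ) → 2 ≤ m → (k : Fin m → ℕ) → (w : List ℕ) → InS m k w →
    (p x : ℕ) → at w p ≡ just x →
      (x ≡ m → at (θ! (m ∸ 2) w) p ≡ just m)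
      × (x < m → ∃[ c ] (at (θ! (m ∸ 2) w) p ≡ just c × ∃[ s ] (s ∈ R m w p × c ≡ s ∸ 1)))
lemma5p3 m@(suc (suc j)) (s≤s (s≤s z≤n)) _ w (letters , _) p x w[p]≡x
  with Tracks-at (descends-θ! {pv = m} j (All.map proj₁ letters)) w[p]≡x
... | y , θw[p]≡y , d = top , below
  where
    open Descends d
    context : List ℕ
    context = letterBefore m w p ∷ x ∷ drop (suc p) w

    ∈R : ∀ {s} → s ∈ context ++ [ m ] → s ∈ R m w p
    ∈R = subst (_ ∈_) (sym (R-context m w p w[p]≡x))

    top : x ≡ m → at (θ! j w) p ≡ just m
    top refl = trans θw[p]≡y (cong just (high-fixed ≤-refl))

    below : x < m → ∃[ c ] (at (θ! j w) p ≡ just c × ∃[ s ] (s ∈ R m w p × c ≡ s ∸ 1))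
    below (s≤s x≤1+j) with low-descends x≤1+j
    ... | inj₁ 1+y∈ = y , θw[p]≡y , suc y , ∈R (∈-++⁺ˡ 1+y∈) , refl
    ... | inj₂ refl = y , θw[p]≡y , m , ∈R (∈-++⁺ʳ context (here refl)) , refl
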